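{- Consider a proof in $\mathcal{G}$ of the form: a tailless proof $\pi_1$ of $\Phi \vdash C$ followed by applications of (W) yielding $\Theta, A, \Gamma \vdash C$, a tailless proof $\pi_2$ of $\Psi \vdash C$ followed by applications of (W) yielding $\Theta, B, \Gamma \vdash C$, and a final application of ($\vee$L) with conclusion $\Theta, A\vee B, \Gamma \vdash C$. Then this proof can be transformed into a W-normal proof of the same degree of the form: a tailless proof $\pi$ of some $\Xi \vdash C$ followed by applications of (W) yielding $\Theta, A \vee B, \Gamma \vdash C$, such that for every occurrence $G$ of a formula in $\Theta$, if in the original proof there are $k_1$ applications of (W) above the left premise of ($\vee$L) tied to (the occurrence corresponding to) $G$ and $k_2$ applications of (W) above the right premise tied to $G$, then in the new proof there are $\max(k_1,k_2)$ applications of (W) tied to $G$. The same holds for occurrences of formulae in $\Gamma$.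
   Context: Formulae are built from propositional variables and $\bot$ with the binary connectives $\wedge,\vee,\rightarrow$. Sequents have the form $\Gamma \vdash C$, $\Gamma$ a finite (possibly empty) sequence of formulae, $C$ a formula. The system $\mathcal{G}$ has axioms $A \vdash A$ and $\bot \vdash A$ and rules: (C) from $\Delta, A, B, \Gamma \vdash C$ infer $\Delta, B, A, \Gamma \vdash C$; (W) from $\Theta, A, A, \Gamma \vdash C$ infer $\Theta, A, \Gamma \vdash C$; (K) from $\Theta, \Gamma \vdash C$ infer $\Theta, A, \Gamma \vdash C$; (cut) from $\Delta \vdash A$ and $\Theta, A, \Gamma \vdash C$ infer $\Theta, \Delta, \Gamma \vdash C$; ($\wedge$L) from $\Theta, A, \Gamma \vdash C$ (resp. $\Theta, B, \Gamma \vdash C$) infer $\Theta, A\wedge B, \Gamma \vdash C$; ($\wedge$R) from $\Gamma \vdash A$ and $\Gamma \vdash B$ infer $\Gamma \vdash A \wedge B$; ($\vee$L) from $\Theta, A, \Gamma \vdash C$ and $\Theta, B, \Gamma \vdash C$ infer $\Theta, A \vee B, \Gamma \vdash C$; ($\vee$R) from $\Gamma \vdash A$ (resp. $\Gamma \vdash B$) infer $\Gamma \vdash A \vee B$; ($\rightarrow$L) from $\Delta \vdash A$ and $\Theta, B, \Gamma \vdash C$ infer $\Theta, \Delta, A \rightarrow B, \Gamma \vdash C$; ($\rightarrow$R) from $A, \Gamma \vdash B$ infer $\Gamma \vdash A \rightarrow B$. The degree of a cut is the number of binary connectives in its cut formula; the degree of a proof is the maximal degree of its cuts (0 if none). Clusters: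 in each inference, each occurrence of a formula in the antecedent of the conclusion lying in a context sequence ($\Theta,\Delta,\Gamma$ of the schema) has as immediate ancestors the occurrences at the corresponding place in the premise(s); in (C) the displayed $B,A$ of the conclusion have as immediate ancestors the displayed $B,A$ of the premise; in (W) the displayed contracted occurrence of $A$ in the conclusion has both displayed occurrences of $A$ of the premise as immediate ancestors. The cluster of an occurrence $G$ is the set of occurrences obtained from $G$ by iterating the immediate-ancestor relation (including $G$). An application of (W) in a proof of $\Gamma \vdash C$ is tied to an occurrence $G$ of a formula in $\Gamma$ iff the principal (contracted) occurrence in the conclusion of this application belongs to the cluster of $G$. A proof is W-normal iff every application of (W) in it either is the last rule of the proof, or has only applications of (W) below it, or is the upper rule in one of the two contexts: (i) $\Theta, A, A, A, \Gamma \vdash C$ by (W) to $\Theta, A, A, \Gamma \vdash C$ followed by (W) to $\Theta, A, \Gamma \vdash C$; (ii) $A, A, \Gamma \vdash B$ by (W) to $A, \Gamma \vdash B$ followed by ($\rightarrow$R) to $\Gamma \vdash A \rightarrow B$. A W-normal proof is tailless iff its last rule is not (W). -}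

module Defs where

open import Data.Nat using (ℕ; zero; suc; _+_; _∸_; _⊔_; _<ᵇ_; _≡ᵇ_)
open import Data.List using (List; []; _∷_; _++_; [_]; length)
open import Data.Bool using (Bool; true; false; if_then_else_)
open import Data.Product using (_×_)
open import Data.Sum using (_⊎_)
open import Data.Unit using (⊤)
open import Data.Empty using (⊥)
open import Relation.Binary.PropositionalEquality using (_≡_)

infixr 6 _∧_
infixr 5 _∨_
infixr 4 _⇒_

data Fm : Set where
  var  : ℕ → Fm
  bot  : Fm
  _∧_  : Fm → Fm → Fm
  _∨_  : Fm → Fm → Fm
  _⇒_  : Fm → Fm → Fm

size : Fm → ℕ
size (var _) = 0
size bot     = 0
size (A ∧ B) = suc (size A + size B)
size (A ∨ B) = suc (size A + size B)
size (A ⇒ B) = suc (size A + size B)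

infix 2 _⊢_

data _⊢_ : List Fm → Fm → Set where
  ax    : ∀ {A} → [ A ] ⊢ A
  botL  : ∀ {A} → [ bot ] ⊢ A
  -- (C)
  exch  : ∀ Δ Γ {A B C} → Δ ++ A ∷ B ∷ Γ ⊢ C → Δ ++ B ∷ A ∷ Γ ⊢ C
  -- (W)
  contr : ∀ Θ Γ {A C} → Θ ++ A ∷ A ∷ Γ ⊢ C → Θ ++ A ∷ Γ ⊢ C
  -- (K)
  thin  : ∀ Θ A Γ {C} → Θ ++ Γ ⊢ C → Θ ++ A ∷ Γ ⊢ C
  cut   : ∀ Δ Θ Γ {A C} → Δ ⊢ A → Θ ++ A ∷ Γ ⊢ C → Θ ++ Δ ++ Γ ⊢ C
  ∧L₁   : ∀ Θ Γ {A B C} → Θ ++ A ∷ Γ ⊢ C → Θ ++ (A ∧ B) ∷ Γ ⊢ C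
  ∧L₂   : ∀ Θ Γ {A B C} → Θ ++ B ∷ Γ ⊢ C → Θ ++ (A ∧ B) ∷ Γ ⊢ C
  ∧R    : ∀ {Γ A B} → Γ ⊢ A → Γ ⊢ B → Γ ⊢ A ∧ B
  ∨L    : ∀ Θ Γ {A B C} → Θ ++ A ∷ Γ ⊢ C → Θ ++ B ∷ Γ ⊢ C → Θ ++ (A ∨ B) ∷ Γ ⊢ C
  ∨R₁   : ∀ {Γ A B} → Γ ⊢ A → Γ ⊢ A ∨ B
  ∨R₂   : ∀ {Γ A B} → Γ ⊢ B → Γ ⊢ A ∨ B
  ⇒L    : ∀ Δ Θ Γ {A B C} → Δ ⊢ A → Θ ++ B ∷ Γ ⊢ C → Θ ++ Δ ++ (A ⇒ B) ∷ Γ ⊢ C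
  ⇒R    : ∀ {Γ A B} → A ∷ Γ ⊢ B → Γ ⊢ A ⇒ B

deg : ∀ {Γ C} → Γ ⊢ C → ℕ
deg ax = 0
deg botL = 0
deg (exch _ _ p) = deg p
deg (contr _ _ p) = deg p
deg (thin _ _ _ p) = deg p
deg (cut _ _ _ {A} q p) = size A ⊔ deg q ⊔ deg p
deg (∧L₁ _ _ p) = deg p
deg (∧L₂ _ _ p) = deg p
deg (∧R p q) = deg p ⊔ deg q
deg (∨L _ _ p q) = deg p ⊔ deg q
deg (∨R₁ p) = deg p
deg (∨R₂ p) = deg p
deg (⇒L _ _ _ q p) = deg q ⊔ deg p
deg (⇒R p) = deg p

-- Number of applications of (W) tied to the occurrence at position i
-- (0-based) of the antecedent of the end-sequent, i.e. the number of
-- (W)-applications whose principal (contracted) occurrence lies in the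
-- cluster of that occurrence.  Since each occurrence in a premise has at
-- most one immediate descendant, the cluster is a tree and counting by
-- summation over immediate ancestors is exact.

tiedW : ∀ {Γ C} → Γ ⊢ C → ℕ → ℕ
tiedW ax i = 0
tiedW botL i = 0
tiedW (exch Δ _ p) i =
  if i ≡ᵇ length Δ then tiedW p (suc i)
  else if i ≡ᵇ suc (length Δ) then tiedW p (length Δ)
  else tiedW p i
tiedW (contr Θ _ p) i =
  if i <ᵇ length Θ then tiedW p i
  else if i ≡ᵇ length Θ then suc (tiedW p i + tiedW p (suc i))
  else tiedW p (suc i)
tiedW (thin Θ _ _ p) i =
  if i <ᵇ length Θ then tiedW p i
  else if i ≡ᵇ length Θ then 0
  else tiedW p (i ∸ 1)
tiedW (cut Δ Θ _ q p) i =
  if i <ᵇ length Θ then tiedW p i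
  else if i <ᵇ length Θ + length Δ then tiedW q (i ∸ length Θ)
  else tiedW p (suc (i ∸ length Δ))
tiedW (∧L₁ Θ _ p) i = if i ≡ᵇ length Θ then 0 else tiedW p i
tiedW (∧L₂ Θ _ p) i = if i ≡ᵇ length Θ then 0 else tiedW p i
tiedW (∧R p q) i = tiedW p i + tiedW q i
tiedW (∨L Θ _ p q) i = if i ≡ᵇ length Θ then 0 else tiedW p i + tiedW q i
tiedW (∨R₁ p) i = tiedW p i
tiedW (∨R₂ p) i = tiedW p i
tiedW (⇒L Δ Θ _ q p) i =
  if i <ᵇ length Θ then tiedW p i
  else if i <ᵇ length Θ + length Δ then tiedW q (i ∸ length Θ)
  else if i ≡ᵇ length Θ + length Δ then 0
  else tiedW p (i ∸ length Δ)
tiedW (⇒R p) i = tiedW p (suc i)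

-- the rule immediately below the current subproof
data Parent : Set where
  pNone  : Parent          -- current subproof is the whole proof
  pW     : ℕ → Parent      -- an application of (W) whose principal position is k
  pArrR  : Parent
  pOther : Parent

-- Condition on an application of (W) with principal position j, given
-- whether only (W)'s are below it (b) and the rule immediately below it.
WOK : Bool → Parent → ℕ → Set
WOK true  _        j = ⊤
WOK false (pW k)   j = j ≡ k ⊎ j ≡ suc k
WOK false pArrR    j = j ≡ 0
WOK false pNone    j = ⊤
WOK false pOther   j = ⊥

WN : ∀ {Γ C} → Bool → Parent → Γ ⊢ C → Set
WN b par ax = ⊤
WN b par botL = ⊤
WN b par (exch _ _ p) = WN false pOther p
WN b par (contr Θ _ p) = WOK b par (length Θ) × WN b (pW (length Θ)) p
WN b par (thin _ _ _ p) = WN false pOther p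
WN b par (cut _ _ _ q p) = WN false pOther q × WN false pOther p
WN b par (∧L₁ _ _ p) = WN false pOther p
WN b par (∧L₂ _ _ p) = WN false pOther p
WN b par (∧R p q) = WN false pOther p × WN false pOther q
WN b par (∨L _ _ p q) = WN false pOther p × WN false pOther q
WN b par (∨R₁ p) = WN false pOther p
WN b par (∨R₂ p) = WN false pOther p
WN b par (⇒L _ _ _ q p) = WN false pOther q × WN false pOther p
WN b par (⇒R p) = WN false pArrR p

WNormal : ∀ {Γ C} → Γ ⊢ C → Set
WNormal p = WN true pNone p

NotW : ∀ {Γ C} → Γ ⊢ C → Set
NotW (contr _ _ _) = ⊥
NotW _ = ⊤

Tailless : ∀ {Γ C} → Γ ⊢ C → Set
Tailless p = WNormal p × NotW p

data TaillessThenW : ∀ {Γ C} → Γ ⊢ C → Set where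
  base  : ∀ {Γ C} {p : Γ ⊢ C} → Tailless p → TaillessThenW p
  wstep : ∀ Θ Γ {A C} {p : Θ ++ A ∷ A ∷ Γ ⊢ C} →
          TaillessThenW p → TaillessThenW (contr Θ Γ p)

{-# OPTIONS --safe #-}
-- The (W)s tied to occurrences of the end-sequent of a W-normal proof all lie in its final block
-- of (W)s. Removing these blocks from π₁ and π₂ leaves tailless proofs in which every formula G
-- of Θ and Γ is repeated 1 + kᵢ(G) times, kᵢ(G) being the number of (W)s tied to it, and A resp. B
-- is repeated 1 + a resp. 1 + b times. Weaken both to 1 + max(k₁(G), k₂(G)) copies of each G and
-- join them into a proof with 1 + a + b copies of A ∨ B by splitting these copies one by one with
-- (∨L): by pigeonhole every branch collects a + 1 copies of A or b + 1 copies of B, and is closed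
-- by a weakening of the first resp. second proof. Contracting all copies again yields a final
-- block with max(k₁(G), k₂(G)) (W)s tied to G. Weakening and (∨L) introduce no cut, so the degree
-- is that of (∨L) applied to π₁ and π₂.

module Submission where

open import Defs
open import Data.Bool using (true; false; T; if_then_else_)
open import Data.List using (List; []; _∷_; _++_; [_]; length; replicate)
open import Data.List.Properties using (++-assoc; length-++)
open import Data.List.Relation.Binary.Sublist.Propositional
  using (_⊆_; []; _∷_; _∷ʳ_; ⊆-refl; ⊆-trans; ⊆-reflexive; minimum)
open import Data.List.Relation.Binary.Sublist.Propositional.Properties using (++⁺; ++⁺ˡ)
open import Data.Nat using (ℕ; zero; suc; _+_; _⊔_; _≤_; _<_; z≤n; s≤s; z<s; s<s; _≟_; _<ᵇ_; _≡ᵇ_)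
open import Data.Nat.Properties
open import Data.Product using (Σ; _×_; _,_)
open import Data.Sum using ([_,_]′)
open import Data.Unit using (tt)
open import Function using (_∘_)
open import Relation.Nullary using (¬_; yes; no; contradiction)
open import Relation.Binary.PropositionalEquality
  using (_≡_; _≢_; refl; sym; trans; cong; cong₂; subst; module ≡-Reasoning)
open import Relation.Binary.Definitions using (tri<; tri≈; tri>)

if-true : ∀ {A : Set} {b} {x y : A} → T b → (if b then x else y) ≡ x
if-true {b = true} _ = refl

if-false : ∀ {A : Set} {b} {x y : A} → ¬ T b → (if b then x else y) ≡ y
if-false {b = false} _  = refl
if-false {b = true}  ¬t = contradiction tt ¬t

if-≡0 : ∀ b {x y} → x ≡ 0 → y ≡ 0 → (if b then x else y) ≡ 0
if-≡0 true  x≡0 _   = x≡0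
if-≡0 false _   y≡0 = y≡0

module _ (Θ Γ : List Fm) {A C} (p : Θ ++ A ∷ A ∷ Γ ⊢ C) where

  tiedW-contr-< : ∀ {i} → i < length Θ → tiedW (contr Θ Γ p) i ≡ tiedW p i
  tiedW-contr-< i<n = if-true (<⇒<ᵇ i<n)

  tiedW-contr-≡ : tiedW (contr Θ Γ p) (length Θ)
                ≡ suc (tiedW p (length Θ) + tiedW p (suc (length Θ)))
  tiedW-contr-≡ = trans (if-false (<-irrefl refl ∘ <ᵇ⇒< (length Θ) (length Θ)))
                        (if-true (≡⇒≡ᵇ (length Θ) (length Θ) refl))

  tiedW-contr-> : ∀ {i} → length Θ < i → tiedW (contr Θ Γ p) i ≡ tiedW p (suc i)
  tiedW-contr-> n<i = trans (if-false (<⇒≯ n<i ∘ <ᵇ⇒< _ (length Θ)))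
                          (if-false (>⇒≢ n<i ∘ ≡ᵇ⇒≡ _ (length Θ)))

_[_≔_] : (ℕ → ℕ) → ℕ → ℕ → ℕ → ℕ
(f [ n ≔ v ]) i with i ≟ n
... | yes _ = v
... | no  _ = f i

update-≡ : ∀ f n v → (f [ n ≔ v ]) n ≡ v
update-≡ f n v with n ≟ n
... | yes _   = refl
... | no  n≢n = contradiction refl n≢n

update-≢ : ∀ f {n} v {i} → i ≢ n → (f [ n ≔ v ]) i ≡ f i
update-≢ f {n} v {i} i≢n with i ≟ n
... | yes i≡n = contradiction i≡n i≢n
... | no  _   = refl

≤-update : ∀ {f g : ℕ → ℕ} {n v} → (∀ i → f i ≤ g i) → f n ≤ v → ∀ i → f i ≤ (g [ n ≔ v ]) i
≤-update {n = n} f≤g fn≤v i with i ≟ n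
... | yes refl = fn≤v
... | no  _    = f≤g i

length-++-[] : ∀ {A : Set} (xs : List A) x → length (xs ++ [ x ]) ≡ suc (length xs)
length-++-[] []       x = refl
length-++-[] (_ ∷ xs) x = cong suc (length-++-[] xs x)

replicate-+ : ∀ {A : Set} m n (x : A) → replicate (m + n) x ≡ replicate m x ++ replicate n x
replicate-+ zero    n x = refl
replicate-+ (suc m) n x = cong (x ∷_) (replicate-+ m n x)

replicate-⊆ : ∀ {A : Set} {m n} (x : A) → m ≤ n → replicate m x ⊆ replicate n x
replicate-⊆ {n = n} x z≤n     = minimum (replicate n x)
replicate-⊆ x         (s≤s m≤n) = refl ∷ replicate-⊆ x m≤n

-- The antecedent above a block of (W)s contracting f i further copies into the i-th formula of L.
expand : List Fm → (ℕ → ℕ) → List Fm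
expand []      f = []
expand (x ∷ L) f = replicate (suc (f 0)) x ++ expand L (f ∘ suc)

expand-cong : ∀ L {f g : ℕ → ℕ} → (∀ i → f i ≡ g i) → expand L f ≡ expand L g
expand-cong []      _   = refl
expand-cong (x ∷ L) f≗g =
  cong₂ (λ k → replicate (suc k) x ++_) (f≗g 0) (expand-cong L (f≗g ∘ suc))

expand-zero : ∀ L {f : ℕ → ℕ} → (∀ i → f i ≡ 0) → expand L f ≡ L
expand-zero []      _   = refl
expand-zero (x ∷ L) f≗0 =
  cong₂ (λ k → replicate (suc k) x ++_) (f≗0 0) (expand-zero L (f≗0 ∘ suc))

expand-⊆ : ∀ L {f g : ℕ → ℕ} → (∀ i → f i ≤ g i) → expand L f ⊆ expand L g
expand-⊆ []      _   = []
expand-⊆ (x ∷ L) f≤g = ++⁺ (replicate-⊆ x (s≤s (f≤g 0))) (expand-⊆ L (f≤g ∘ suc))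

expand-split : ∀ Θ X Γ f {m} → f (length Θ) ≡ m →
  expand (Θ ++ X ∷ Γ) f ≡ expand Θ f ++ replicate (suc m) X ++ expand Γ (λ j → f (length Θ + suc j))
expand-split []      X Γ f refl = refl
expand-split (y ∷ Θ) X Γ f fn≡m =
  trans (cong (replicate (suc (f 0)) y ++_) (expand-split Θ X Γ (f ∘ suc) fn≡m))
        (sym (++-assoc (replicate (suc (f 0)) y) (expand Θ (f ∘ suc)) _))

expand-⊆-around : ∀ Θ X Γ {f g : ℕ → ℕ} → (∀ i → f i ≤ g i) →
  expand (Θ ++ X ∷ Γ) f
    ⊆ expand Θ g ++ replicate (suc (f (length Θ))) X ++ expand Γ (λ j → g (length Θ + suc j))
expand-⊆-around Θ X Γ {f} f≤g =
  ⊆-trans (⊆-reflexive (expand-split Θ X Γ f refl))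
          (++⁺ (expand-⊆ Θ f≤g) (++⁺ ⊆-refl (expand-⊆ Γ (λ j → f≤g (length Θ + suc j)))))

expand-merge : ∀ Θ X Γ {f g : ℕ → ℕ} →
  (∀ {i} → i < length Θ → g i ≡ f i) →
  g (length Θ) ≡ suc (f (length Θ) + f (suc (length Θ))) →
  (∀ {i} → length Θ < i → g i ≡ f (suc i)) →
  expand (Θ ++ X ∷ X ∷ Γ) f ≡ expand (Θ ++ X ∷ Γ) g
expand-merge [] X Γ {f} {g} _ g0 g> = begin
  replicate (suc (f 0)) X ++ replicate (suc (f 1)) X ++ expand Γ (f ∘ suc ∘ suc)
    ≡⟨ sym (++-assoc (replicate (suc (f 0)) X) _ _) ⟩
  (replicate (suc (f 0)) X ++ replicate (suc (f 1)) X) ++ expand Γ (f ∘ suc ∘ suc)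
    ≡⟨ cong₂ _++_ (sym (replicate-+ (suc (f 0)) (suc (f 1)) X))
                  (expand-cong Γ (λ _ → sym (g> z<s))) ⟩
  replicate (suc (f 0) + suc (f 1)) X ++ expand Γ (g ∘ suc)
    ≡⟨ cong (λ k → replicate (suc k) X ++ expand Γ (g ∘ suc)) (trans (+-suc (f 0) (f 1)) (sym g0)) ⟩
  replicate (suc (g 0)) X ++ expand Γ (g ∘ suc) ∎
  where open ≡-Reasoning
expand-merge (y ∷ Θ) X Γ g< g≡ g> =
  cong₂ (λ k → replicate (suc k) y ++_) (sym (g< z<s))
        (expand-merge Θ X Γ (λ i<n → g< (s<s i<n)) g≡ (λ n<i → g> (s<s n<i)))

WN-reparent : ∀ {Γ C} (p : Γ ⊢ C) → NotW p → ∀ {b b′ par par′} → WN b par p → WN b′ par′ p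
WN-reparent ax             _  w = w
WN-reparent botL           _  w = w
WN-reparent (exch _ _ _)   _  w = w
WN-reparent (contr _ _ _)  ()
WN-reparent (thin _ _ _ _) _  w = w
WN-reparent (cut _ _ _ _ _) _ w = w
WN-reparent (∧L₁ _ _ _)    _  w = w
WN-reparent (∧L₂ _ _ _)    _  w = w
WN-reparent (∧R _ _)       _  w = w
WN-reparent (∨L _ _ _ _)   _  w = w
WN-reparent (∨R₁ _)        _  w = w
WN-reparent (∨R₂ _)        _  w = w
WN-reparent (⇒L _ _ _ _ _) _  w = w
WN-reparent (⇒R _)         _  w = w

tailless⇒WN : ∀ {Γ C} {p : Γ ⊢ C} → Tailless p → ∀ {b par} → WN b par p
tailless⇒WN {p = p} (w , notW) = WN-reparent p notW w

TaillessThenW⇒WN : ∀ {Γ C} {p : Γ ⊢ C} → TaillessThenW p → ∀ {par} → WN true par p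
TaillessThenW⇒WN (base tl)       = tailless⇒WN tl
TaillessThenW⇒WN (wstep _ _ tw) = tt , TaillessThenW⇒WN tw

-- A (W) tied to position i of p that is not in a final block of (W)s heads a chain of (W)s in
-- context (i) ending directly above the rule below p, which would thus have to admit a (W) at i.
WN-tiedW≡0 : ∀ {Γ C} par (p : Γ ⊢ C) → WN false par p → ∀ i → ¬ WOK false par i → tiedW p i ≡ 0
premise-tiedW≡0 : ∀ {Γ C} (p : Γ ⊢ C) → WN false pOther p → ∀ i → tiedW p i ≡ 0

premise-tiedW≡0 p w i = WN-tiedW≡0 pOther p w i (λ ())

WN-tiedW≡0 _ ax   _ _ _ = refl
WN-tiedW≡0 _ botL _ _ _ = refl
WN-tiedW≡0 _ (exch Δ _ p) w i _ =
  if-≡0 (i ≡ᵇ length Δ) (premise-tiedW≡0 p w _)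
    (if-≡0 (i ≡ᵇ suc (length Δ)) (premise-tiedW≡0 p w _) (premise-tiedW≡0 p w _))
WN-tiedW≡0 par (contr Θ Γ p) (ok , w) i forbidden with <-cmp i (length Θ)
... | tri< i<n _ _ = trans (tiedW-contr-< Θ Γ p i<n)
      (WN-tiedW≡0 _ p w i [ <⇒≢ i<n , <⇒≢ (m<n⇒m<1+n i<n) ]′)
... | tri≈ _ refl _ = contradiction ok forbidden
... | tri> _ _ n<i = trans (tiedW-contr-> Θ Γ p n<i)
      (WN-tiedW≡0 _ p w (suc i) [ >⇒≢ (m<n⇒m<1+n n<i) , >⇒≢ (s<s n<i) ]′)
WN-tiedW≡0 _ (thin Θ _ _ p) w i _ =
  if-≡0 (i <ᵇ length Θ) (premise-tiedW≡0 p w _)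
    (if-≡0 (i ≡ᵇ length Θ) refl (premise-tiedW≡0 p w _))
WN-tiedW≡0 _ (cut Δ Θ _ q p) (wq , wp) i _ =
  if-≡0 (i <ᵇ length Θ) (premise-tiedW≡0 p wp _)
    (if-≡0 (i <ᵇ length Θ + length Δ) (premise-tiedW≡0 q wq _) (premise-tiedW≡0 p wp _))
WN-tiedW≡0 _ (∧L₁ Θ _ p) w i _ = if-≡0 (i ≡ᵇ length Θ) refl (premise-tiedW≡0 p w i)
WN-tiedW≡0 _ (∧L₂ Θ _ p) w i _ = if-≡0 (i ≡ᵇ length Θ) refl (premise-tiedW≡0 p w i)
WN-tiedW≡0 _ (∧R p q) (wp , wq) i _ = cong₂ _+_ (premise-tiedW≡0 p wp i) (premise-tiedW≡0 q wq i)
WN-tiedW≡0 _ (∨L Θ _ p q) (wp , wq) i _ =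
  if-≡0 (i ≡ᵇ length Θ) refl (cong₂ _+_ (premise-tiedW≡0 p wp i) (premise-tiedW≡0 q wq i))
WN-tiedW≡0 _ (∨R₁ p) w i _ = premise-tiedW≡0 p w i
WN-tiedW≡0 _ (∨R₂ p) w i _ = premise-tiedW≡0 p w i
WN-tiedW≡0 _ (⇒L Δ Θ _ q p) (wq , wp) i _ =
  if-≡0 (i <ᵇ length Θ) (premise-tiedW≡0 p wp _)
    (if-≡0 (i <ᵇ length Θ + length Δ) (premise-tiedW≡0 q wq _)
      (if-≡0 (i ≡ᵇ length Θ + length Δ) refl (premise-tiedW≡0 p wp _)))
WN-tiedW≡0 _ (⇒R p) w i _ = WN-tiedW≡0 pArrR p w (suc i) (λ ())

tailless-tiedW≡0 : ∀ {Γ C} {p : Γ ⊢ C} → Tailless p → ∀ i → tiedW p i ≡ 0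
tailless-tiedW≡0 {p = p} tl = premise-tiedW≡0 p (tailless⇒WN tl)

cast : ∀ {Γ Γ′ C} → Γ ≡ Γ′ → Γ ⊢ C → Γ′ ⊢ C
cast refl p = p

deg-cast : ∀ {Γ Γ′ C} (e : Γ ≡ Γ′) (p : Γ ⊢ C) → deg (cast e p) ≡ deg p
deg-cast refl p = refl

tiedW-cast : ∀ {Γ Γ′ C} (e : Γ ≡ Γ′) (p : Γ ⊢ C) i → tiedW (cast e p) i ≡ tiedW p i
tiedW-cast refl p i = refl

TaillessThenW-cast : ∀ {Γ Γ′ C} (e : Γ ≡ Γ′) {p : Γ ⊢ C} →
  TaillessThenW p → TaillessThenW (cast e p)
TaillessThenW-cast refl tw = tw

record TaillessProof (Γ : List Fm) (C : Fm) (d : ℕ) : Set where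
  constructor ⟨_,_,_⟩
  field
    proof    : Γ ⊢ C
    tailless : Tailless proof
    degree   : deg proof ≡ d

castTP : ∀ {Γ Γ′ C d} → Γ ≡ Γ′ → TaillessProof Γ C d → TaillessProof Γ′ C d
castTP refl t = t

castDegree : ∀ {Γ C d d′} → d ≡ d′ → TaillessProof Γ C d → TaillessProof Γ C d′
castDegree refl t = t

shiftTP : ∀ Θ X {Δ C d} → TaillessProof (Θ ++ X ∷ Δ) C d → TaillessProof ((Θ ++ [ X ]) ++ Δ) C d
shiftTP Θ X = castTP (sym (++-assoc Θ [ X ] _))

unshiftTP : ∀ Θ X {Δ C d} → TaillessProof ((Θ ++ [ X ]) ++ Δ) C d → TaillessProof (Θ ++ X ∷ Δ) C d
unshiftTP Θ X = castTP (++-assoc Θ [ X ] _)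

thinTP : ∀ Θ X {Γ C d} → TaillessProof (Θ ++ Γ) C d → TaillessProof (Θ ++ X ∷ Γ) C d
thinTP Θ X ⟨ p , tl , dp ⟩ = ⟨ thin Θ X _ p , (tailless⇒WN tl , tt) , dp ⟩

∨L-TP : ∀ Θ Γ {A B C d₁ d₂} → TaillessProof (Θ ++ A ∷ Γ) C d₁ → TaillessProof (Θ ++ B ∷ Γ) C d₂ →
  TaillessProof (Θ ++ (A ∨ B) ∷ Γ) C (d₁ ⊔ d₂)
∨L-TP Θ Γ ⟨ p , tp , dp ⟩ ⟨ q , tq , dq ⟩ =
  ⟨ ∨L Θ Γ p q , ((tailless⇒WN tp , tailless⇒WN tq) , tt) , cong₂ _⊔_ dp dq ⟩

weaken-after : ∀ P {Φ Ξ C d} → Φ ⊆ Ξ → TaillessProof (P ++ Φ) C d → TaillessProof (P ++ Ξ) C d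
weaken-after P []         t = t
weaken-after P (y ∷ʳ Φ⊆Ξ) t = thinTP P y (weaken-after P Φ⊆Ξ t)
weaken-after P (_∷_ {x = x} refl Φ⊆Ξ) t =
  unshiftTP P x (weaken-after (P ++ [ x ]) Φ⊆Ξ (shiftTP P x t))

weaken : ∀ {Φ Ξ C d} → Φ ⊆ Ξ → TaillessProof Φ C d → TaillessProof Ξ C d
weaken = weaken-after []

removeTail : ∀ {L C} {π : L ⊢ C} → TaillessThenW π → TaillessProof (expand L (tiedW π)) C (deg π)
removeTail {L} {π = π} (base tl) =
  castTP (sym (expand-zero L (tailless-tiedW≡0 tl))) ⟨ π , tl , refl ⟩
removeTail (wstep Θ Γ {p = p} tw) =
  castTP (expand-merge Θ _ Γ (tiedW-contr-< Θ Γ p) (tiedW-contr-≡ Θ Γ p) (tiedW-contr-> Θ Γ p))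
         (removeTail tw)

⊆-insert : ∀ Θ (X : Fm) Δ Γ → Θ ++ X ∷ Γ ⊆ Θ ++ X ∷ Δ ++ Γ
⊆-insert Θ X Δ Γ = ++⁺ ⊆-refl (refl ∷ ++⁺ˡ Δ ⊆-refl)

module _ {A B C : Fm} {d₁ d₂ : ℕ} where

  ∨L-replicate : ∀ a b Θ Γ →
    TaillessProof (Θ ++ replicate (suc a) A ++ Γ) C d₁ →
    TaillessProof (Θ ++ replicate (suc b) B ++ Γ) C d₂ →
    TaillessProof (Θ ++ replicate (suc (a + b)) (A ∨ B) ++ Γ) C (d₁ ⊔ d₂)

  A-branch : ∀ a b Θ Γ →
    TaillessProof (Θ ++ replicate (suc (suc a)) A ++ Γ) C d₁ →
    TaillessProof (Θ ++ replicate (suc b) B ++ Γ) C d₂ →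
    TaillessProof (Θ ++ A ∷ replicate (suc (a + b)) (A ∨ B) ++ Γ) C (d₁ ⊔ d₂)
  A-branch a b Θ Γ t₁ t₂ =
    unshiftTP Θ A (∨L-replicate a b (Θ ++ [ A ]) Γ (shiftTP Θ A t₁) (shiftTP Θ A (thinTP Θ A t₂)))

  B-branch : ∀ a b Θ Γ →
    TaillessProof (Θ ++ replicate (suc a) A ++ Γ) C d₁ →
    TaillessProof (Θ ++ replicate (suc (suc b)) B ++ Γ) C d₂ →
    TaillessProof (Θ ++ B ∷ replicate (suc (a + b)) (A ∨ B) ++ Γ) C (d₁ ⊔ d₂)
  B-branch a b Θ Γ t₁ t₂ =
    unshiftTP Θ B (∨L-replicate a b (Θ ++ [ B ]) Γ (shiftTP Θ B (thinTP Θ B t₁)) (shiftTP Θ B t₂))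

  ∨L-replicate zero zero Θ Γ t₁ t₂ = ∨L-TP Θ Γ t₁ t₂
  ∨L-replicate zero (suc b) Θ Γ t₁ t₂ =
    castDegree (trans (sym (⊔-assoc d₁ d₁ d₂)) (cong (_⊔ d₂) (⊔-idem d₁)))
      (∨L-TP Θ _ (weaken (⊆-insert Θ A (replicate (suc b) (A ∨ B)) Γ) t₁)
                 (B-branch zero b Θ Γ t₁ t₂))
  ∨L-replicate (suc a) zero Θ Γ t₁ t₂ =
    castDegree (trans (⊔-assoc d₁ d₂ d₂) (cong (d₁ ⊔_) (⊔-idem d₂)))
      (∨L-TP Θ _ (A-branch a zero Θ Γ t₁ t₂)
                 (weaken (⊆-insert Θ B (replicate (suc a + 0) (A ∨ B)) Γ) t₂))
  ∨L-replicate (suc a) (suc b) Θ Γ t₁ t₂ =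
    castDegree (⊔-idem (d₁ ⊔ d₂))
      (∨L-TP Θ _ (A-branch a (suc b) Θ Γ t₁ t₂)
        (castTP (cong (λ k → Θ ++ B ∷ replicate k (A ∨ B) ++ Γ) (sym (+-suc (suc a) b)))
          (B-branch (suc a) b Θ Γ t₁ t₂)))

UntiedFrom : ∀ {Γ C} → ℕ → Γ ⊢ C → Set
UntiedFrom n p = ∀ {i} → n ≤ i → tiedW p i ≡ 0

module _ (P : List Fm) {x : Fm} {S : List Fm} {C : Fm} where

  reassoc : P ++ x ∷ S ≡ (P ++ [ x ]) ++ S
  reassoc = sym (++-assoc P [ x ] S)

  contractCopies : ∀ k → P ++ replicate (suc k) x ++ S ⊢ C → (P ++ [ x ]) ++ S ⊢ C
  contractCopies zero    t = cast reassoc t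
  contractCopies (suc k) t = contractCopies k (contr P (replicate k x ++ S) t)

  deg-contractCopies : ∀ k t → deg (contractCopies k t) ≡ deg t
  deg-contractCopies zero    t = deg-cast reassoc t
  deg-contractCopies (suc k) t = deg-contractCopies k _

  TaillessThenW-contractCopies : ∀ k {t} → TaillessThenW t → TaillessThenW (contractCopies k t)
  TaillessThenW-contractCopies zero    tw = TaillessThenW-cast reassoc tw
  TaillessThenW-contractCopies (suc k) tw = TaillessThenW-contractCopies k (wstep P _ tw)

  tiedW-contractCopies-< : ∀ k t {i} → i < length P → tiedW (contractCopies k t) i ≡ tiedW t i
  tiedW-contractCopies-< zero    t {i} _ = tiedW-cast reassoc t i
  tiedW-contractCopies-< (suc k) t i<n =
    trans (tiedW-contractCopies-< k _ i<n) (tiedW-contr-< P (replicate k x ++ S) t i<n)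

  UntiedFrom-contr : ∀ k (t : P ++ x ∷ x ∷ replicate k x ++ S ⊢ C) →
    UntiedFrom (suc (length P)) t → UntiedFrom (suc (length P)) (contr P (replicate k x ++ S) t)
  UntiedFrom-contr k t untied n<i =
    trans (tiedW-contr-> P (replicate k x ++ S) t n<i) (untied (m<n⇒m<1+n n<i))

  UntiedFrom-contractCopies : ∀ k t → UntiedFrom (suc (length P)) t →
    UntiedFrom (length (P ++ [ x ])) (contractCopies k t)
  UntiedFrom-contractCopies zero t untied {i} n≤i =
    trans (tiedW-cast reassoc t i) (untied (subst (_≤ _) (length-++-[] P x) n≤i))
  UntiedFrom-contractCopies (suc k) t untied =
    UntiedFrom-contractCopies k _ (UntiedFrom-contr k t untied)

  tiedW-contractCopies-≡ : ∀ k t → UntiedFrom (suc (length P)) t →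
    tiedW (contractCopies k t) (length P) ≡ k + tiedW t (length P)
  tiedW-contractCopies-≡ zero    t _      = tiedW-cast reassoc t (length P)
  tiedW-contractCopies-≡ (suc k) t untied = begin
    tiedW (contractCopies k t′) n
      ≡⟨ tiedW-contractCopies-≡ k t′ (UntiedFrom-contr k t untied) ⟩
    k + tiedW t′ n                         ≡⟨ cong (k +_) (tiedW-contr-≡ P (replicate k x ++ S) t) ⟩
    k + suc (tiedW t n + tiedW t (suc n))  ≡⟨ cong (λ m → k + suc (tiedW t n + m)) (untied ≤-refl) ⟩
    k + suc (tiedW t n + 0)                ≡⟨ +-suc k _ ⟩
    suc k + (tiedW t n + 0)                ≡⟨ cong (suc k +_) (+-identityʳ _) ⟩
    suc k + tiedW t n                      ∎
    where
    open ≡-Reasoning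
    n : ℕ
    n = length P
    t′ : P ++ x ∷ replicate k x ++ S ⊢ C
    t′ = contr P (replicate k x ++ S) t

contractAll : ∀ P L (f : ℕ → ℕ) {C} → P ++ expand L f ⊢ C → P ++ L ⊢ C
contractAll P []      f t = t
contractAll P (x ∷ L) f t =
  cast (++-assoc P [ x ] L) (contractAll (P ++ [ x ]) L (f ∘ suc) (contractCopies P (f 0) t))

deg-contractAll : ∀ P L f {C} (t : P ++ expand L f ⊢ C) → deg (contractAll P L f t) ≡ deg t
deg-contractAll P []      f t = refl
deg-contractAll P (x ∷ L) f t =
  trans (deg-cast (++-assoc P [ x ] L) _)
        (trans (deg-contractAll (P ++ [ x ]) L (f ∘ suc) _) (deg-contractCopies P (f 0) t))

TaillessThenW-contractAll : ∀ P L f {C} {t : P ++ expand L f ⊢ C} →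
  TaillessThenW t → TaillessThenW (contractAll P L f t)
TaillessThenW-contractAll P []      f tw = tw
TaillessThenW-contractAll P (x ∷ L) f tw =
  TaillessThenW-cast (++-assoc P [ x ] L)
    (TaillessThenW-contractAll (P ++ [ x ]) L (f ∘ suc) (TaillessThenW-contractCopies P (f 0) tw))

tiedW-contractAll-< : ∀ P L f {C} (t : P ++ expand L f ⊢ C) {i} → i < length P →
  tiedW (contractAll P L f t) i ≡ tiedW t i
tiedW-contractAll-< P []      f t _ = refl
tiedW-contractAll-< P (x ∷ L) f t {i} i<n =
  trans (tiedW-cast (++-assoc P [ x ] L) _ i)
    (trans (tiedW-contractAll-< (P ++ [ x ]) L (f ∘ suc) _ i<n+1)
           (tiedW-contractCopies-< P (f 0) t i<n))
  where
  i<n+1 : i < length (P ++ [ x ])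
  i<n+1 = subst (i <_) (sym (length-++-[] P x)) (m<n⇒m<1+n i<n)

tiedW-contractAll-head : ∀ P x L f {C} (t : P ++ expand (x ∷ L) f ⊢ C) → UntiedFrom (length P) t →
  tiedW (contractAll P (x ∷ L) f t) (length P) ≡ f 0
tiedW-contractAll-head P x L f {C} t untied = begin
  tiedW (cast (++-assoc P [ x ] L) rest) n ≡⟨ tiedW-cast (++-assoc P [ x ] L) rest n ⟩
  tiedW rest n                    ≡⟨ tiedW-contractAll-< (P ++ [ x ]) L (f ∘ suc) t′ n<n+1 ⟩
  tiedW t′ n                      ≡⟨ tiedW-contractCopies-≡ P (f 0) t (λ n<i → untied (<⇒≤ n<i)) ⟩
  f 0 + tiedW t n                 ≡⟨ cong (f 0 +_) (untied ≤-refl) ⟩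
  f 0 + 0                         ≡⟨ +-identityʳ (f 0) ⟩
  f 0                             ∎
  where
  open ≡-Reasoning
  n : ℕ
  n = length P
  t′ : (P ++ [ x ]) ++ expand L (f ∘ suc) ⊢ C
  t′ = contractCopies P (f 0) t
  rest : (P ++ [ x ]) ++ L ⊢ C
  rest = contractAll (P ++ [ x ]) L (f ∘ suc) t′
  n<n+1 : n < length (P ++ [ x ])
  n<n+1 = subst (n <_) (sym (length-++-[] P x)) ≤-refl

tiedW-contractAll : ∀ P L f {C} (t : P ++ expand L f ⊢ C) → UntiedFrom (length P) t →
  ∀ {j} → j < length L → tiedW (contractAll P L f t) (length P + j) ≡ f j
tiedW-contractAll P (x ∷ L) f t untied {zero} _ =
  trans (cong (tiedW (contractAll P (x ∷ L) f t)) (+-identityʳ (length P)))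
        (tiedW-contractAll-head P x L f t untied)
tiedW-contractAll P (x ∷ L) f {C} t untied {suc j} (s≤s j<L) =
  trans (tiedW-cast (++-assoc P [ x ] L) rest (length P + suc j))
    (trans (cong (tiedW rest) (trans (+-suc (length P) j) (cong (_+ j) (sym (length-++-[] P x)))))
           (tiedW-contractAll (P ++ [ x ]) L (f ∘ suc) t′ untied′ j<L))
  where
  t′ : (P ++ [ x ]) ++ expand L (f ∘ suc) ⊢ C
  t′ = contractCopies P (f 0) t
  rest : (P ++ [ x ]) ++ L ⊢ C
  rest = contractAll (P ++ [ x ]) L (f ∘ suc) t′
  untied′ : UntiedFrom (length (P ++ [ x ])) t′
  untied′ = UntiedFrom-contractCopies P (f 0) t (λ n<i → untied (<⇒≤ n<i))

contract : ∀ {L C d} f → TaillessProof (expand L f) C d →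
  Σ (L ⊢ C) λ π → TaillessThenW π × deg π ≡ d × (∀ {j} → j < length L → tiedW π j ≡ f j)
contract {L} f ⟨ t , tl , dt ⟩ =
  contractAll [] L f t ,
  TaillessThenW-contractAll [] L f (base tl) ,
  trans (deg-contractAll [] L f t) dt ,
  tiedW-contractAll [] L f t (λ {i} _ → tailless-tiedW≡0 tl i)

lemma5p3 : (Θ Γ : List Fm) (A B C : Fm)
    (π₁ : Θ ++ A ∷ Γ ⊢ C) (π₂ : Θ ++ B ∷ Γ ⊢ C) →
    TaillessThenW π₁ → TaillessThenW π₂ →
    Σ (Θ ++ (A ∨ B) ∷ Γ ⊢ C) λ π →
      WNormal π × TaillessThenW π × deg π ≡ deg (∨L Θ Γ π₁ π₂)
      × (∀ i → i < length Θ → tiedW π i ≡ tiedW π₁ i ⊔ tiedW π₂ i)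
      × (∀ j → j < length Γ →
           tiedW π (length Θ + suc j)
             ≡ tiedW π₁ (length Θ + suc j) ⊔ tiedW π₂ (length Θ + suc j))
lemma5p3 Θ Γ A B C π₁ π₂ tw₁ tw₂ =
  let (π , tπ , degπ , tiedπ) = contract k combined in
  π , TaillessThenW⇒WN tπ , tπ , degπ ,
  (λ i i<n → trans (tiedπ (inΘ i<n)) (update-≢ k₁⊔k₂ _ (<⇒≢ i<n))) ,
  (λ j j<m → trans (tiedπ (inΓ j<m)) (update-≢ k₁⊔k₂ _ (>⇒≢ (m<m+n n z<s))))
  where
  n : ℕ
  n = length Θ
  k₁⊔k₂ : ℕ → ℕ
  k₁⊔k₂ i = tiedW π₁ i ⊔ tiedW π₂ i
  k : ℕ → ℕ
  k = k₁⊔k₂ [ n ≔ tiedW π₁ n + tiedW π₂ n ]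
  stripped : ∀ {X} {π : Θ ++ X ∷ Γ ⊢ C} → TaillessThenW π → (∀ i → tiedW π i ≤ k i) →
    TaillessProof (expand Θ k ++ replicate (suc (tiedW π n)) X ++ expand Γ (λ j → k (n + suc j)))
                  C (deg π)
  stripped tw ≤k = weaken (expand-⊆-around Θ _ Γ ≤k) (removeTail tw)
  combined : TaillessProof (expand (Θ ++ (A ∨ B) ∷ Γ) k) C (deg π₁ ⊔ deg π₂)
  combined = castTP (sym (expand-split Θ (A ∨ B) Γ k (update-≡ k₁⊔k₂ n _)))
    (∨L-replicate (tiedW π₁ n) (tiedW π₂ n) _ _
      (stripped tw₁ (≤-update (λ i → m≤m⊔n _ _) (m≤m+n _ _)))
      (stripped tw₂ (≤-update (λ i → m≤n⊔m _ _) (m≤n+m _ _))))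
  inΘ : ∀ {i} → i < n → i < length (Θ ++ (A ∨ B) ∷ Γ)
  inΘ i<n = subst (_ <_) (sym (length-++ Θ)) (<-≤-trans i<n (m≤m+n n _))
  inΓ : ∀ {j} → j < length Γ → n + suc j < length (Θ ++ (A ∨ B) ∷ Γ)
  inΓ j<m = subst (_ <_) (sym (length-++ Θ)) (+-monoʳ-< n (s<s j<m))
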